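{- Let $\sigma\in S_n$ and $1\le i\le n-2$. Then $\sigma_i>\sigma_{i+2}$ if and only if either $L(\sigma)_i>L(\sigma)_{i+2}+1$, or $L(\sigma)_i=L(\sigma)_{i+2}+1$ and $L(\sigma)_i\le L(\sigma)_{i+1}$.
   Context: For $\sigma\in S_n$ in one-line notation, the Lehmer code is $L(\sigma)_i=\#\{j>i:\sigma_j<\sigma_i\}$ for $1\le i\le n$. -}

module Defs where

open import Data.Nat using (ℕ; _<_)
open import Data.Fin using (Fin; toℕ; fromℕ<)
open import Data.Fin.Permutation using (Permutation′; _⟨$⟩ʳ_)
open import Data.List using (List; length; filter; allFin)
open import Data.Product using (_×_)
open import Data.Fin.Properties using () renaming (_<?_ to _<ᶠ?_)
open import Relation.Nullary.Decidable using (_×-dec_)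

-- One-line notation: σ_i = σ ⟨$⟩ʳ i (positions and values 0-indexed).
-- Lehmer code: L(σ)_i = #{ j > i : σ_j < σ_i }.
lehmer : ∀ {n} → Permutation′ n → Fin n → ℕ
lehmer {n} σ i =
  length (filter (λ j → (i <ᶠ? j) ×-dec ((σ ⟨$⟩ʳ j) <ᶠ? (σ ⟨$⟩ʳ i))) (allFin n))

-- Split the count defining L(σ)ᵢ at positions i+1 and i+2: writing D(x) for the number
-- of positions after i+2 carrying a value below x, one gets
--   L(σ)ᵢ = [σᵢ₊₁ < σᵢ] + [σᵢ₊₂ < σᵢ] + D(σᵢ),  L(σ)ᵢ₊₁ = [σᵢ₊₂ < σᵢ₊₁] + D(σᵢ₊₁),  L(σ)ᵢ₊₂ = D(σᵢ₊₂),
-- and D is monotone. Each of the four relative orders of σᵢ₊₁, σᵢ₊₂ with respect to σᵢ then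
-- decides the criterion by elementary arithmetic.
module Submission where

open import Defs
open import Data.Nat using (ℕ; zero; suc; _+_; _≤_; _<_; s≤s; s≤s⁻¹)
open import Data.Nat.Properties
  using (suc-injective; +-comm; ≤-trans; <-≤-trans; ≤-<-trans; <⇒≤; <⇒≯; ≤⇒≯; m≤n⇒m<n∨m≡n; n≮n; m≤m+n; m+1+n≰m; ≤-reflexive; <-trans; +-suc)
open import Data.Fin using (Fin; toℕ; fromℕ<)
import Data.Fin as Fin
import Data.Nat.Properties
open import Data.Fin.Properties using (toℕ-fromℕ<; <-cmp; <⇒≢) renaming (_<?_ to _<ᶠ?_)
open import Data.Fin.Permutation using (Permutation′; _⟨$⟩ʳ_)
open import Data.List using ([_]; length; filter; tabulate; allFin)
open import Data.List.Properties using (filter-accept; filter-reject)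
open import Data.List.Relation.Binary.Sublist.Propositional using (⊆-refl)
open import Data.List.Relation.Binary.Sublist.Propositional.Properties using (filter⁺; length-mono-≤)
open import Data.Bool using (true; false)
open import Data.Product using (_×_; _,_)
open import Data.Sum using (_⊎_; inj₁; inj₂)
open import Function using (_∘_; _⇔_; mk⇔; Injective; Injection)
open import Function.Properties.Inverse using (↔⇒↣)
open import Level using (Level)
open import Relation.Binary using (tri<; tri≈; tri>)
open import Relation.Binary.PropositionalEquality
  using (_≡_; _≢_; refl; sym; trans; cong; module ≡-Reasoning)
open import Relation.Nullary using (¬_; does; contradiction)
open import Relation.Nullary.Decidable using (_×-dec_)
open import Relation.Unary using (Pred; Decidable)

private variable
  α β : Level
  A : Set α
  B : Set β
  n m : ℕ

length-filter-tabulate-≗ : ∀ {p r} {P : Pred A p} {R : Pred B r} (P? : Decidable P) (R? : Decidable R)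
  {g : Fin n → A} {h : Fin n → B} → (∀ j → does (P? (g j)) ≡ does (R? (h j))) →
  length (filter P? (tabulate g)) ≡ length (filter R? (tabulate h))
length-filter-tabulate-≗ {n = zero} P? R? same = refl
length-filter-tabulate-≗ {n = suc n} P? R? {g} {h} same
  with does (P? (g Fin.zero)) | does (R? (h Fin.zero)) | same Fin.zero
... | false | .false | refl = length-filter-tabulate-≗ P? R? (same ∘ Fin.suc)
... | true  | .true  | refl = cong suc (length-filter-tabulate-≗ P? R? (same ∘ Fin.suc))

laterAndBelow? : (f : Fin n → Fin m) (q : Fin n) (x : Fin m) → Decidable (λ j → q Fin.< j × f j Fin.< x)
laterAndBelow? f q x j = (q <ᶠ? j) ×-dec (f j <ᶠ? x)

smallerAfter : (Fin n → Fin m) → Fin n → Fin m → ℕ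
smallerAfter {n} f q x = length (filter (laterAndBelow? f q x) (allFin n))

lehmerCode : (Fin n → Fin m) → Fin n → ℕ
lehmerCode f q = smallerAfter f q (f q)

smallerAfter-mono : (f : Fin n → Fin m) (q : Fin n) {x y : Fin m} → x Fin.≤ y →
  smallerAfter f q x ≤ smallerAfter f q y
smallerAfter-mono {n} f q {x} {y} x≤y =
  length-mono-≤ (filter⁺ (laterAndBelow? f q x) (laterAndBelow? f q y)
                          {as = allFin n} {bs = allFin n} weaken ⊆-refl)
  where
  weaken : ∀ {j k} → j ≡ k → q Fin.< j × f j Fin.< x → q Fin.< k × f k Fin.< y
  weaken refl (q<j , fj<x) = q<j , <-≤-trans fj<x x≤y

smallerAfter-suc : (f : Fin (suc n) → Fin m) (q : Fin n) (x : Fin m) →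
  smallerAfter f (Fin.suc q) x ≡ smallerAfter (f ∘ Fin.suc) q x
smallerAfter-suc f q x =
  length-filter-tabulate-≗ (laterAndBelow? f (Fin.suc q) x) (laterAndBelow? (f ∘ Fin.suc) q x)
    {g = Fin.suc} {h = λ j → j} λ j → refl

smallerAfter-next : (f : Fin n → Fin m) {q q′ : Fin n} (x : Fin m) → toℕ q′ ≡ suc (toℕ q) →
  smallerAfter f q x ≡ length (filter (_<ᶠ? x) [ f q′ ]) + smallerAfter f q′ x
smallerAfter-next f {Fin.zero} {Fin.suc Fin.zero} x refl
  with does (f (Fin.suc Fin.zero) <ᶠ? x)
     | length-filter-tabulate-≗ (laterAndBelow? f Fin.zero x) (laterAndBelow? f (Fin.suc Fin.zero) x)
         {g = Fin.suc ∘ Fin.suc} {h = Fin.suc ∘ Fin.suc} (λ j → refl)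
... | true  | tails = cong suc tails
... | false | tails = tails
smallerAfter-next f {Fin.zero} {Fin.zero} x ()
smallerAfter-next f {Fin.zero} {Fin.suc (Fin.suc _)} x ()
smallerAfter-next f {Fin.suc q} {Fin.suc q′} x q′≡1+q = begin
  smallerAfter f (Fin.suc q) x                         ≡⟨ smallerAfter-suc f q x ⟩
  smallerAfter (f ∘ Fin.suc) q x                       ≡⟨ smallerAfter-next (f ∘ Fin.suc) x (suc-injective q′≡1+q) ⟩
  below[ f (Fin.suc q′) ] + smallerAfter (f ∘ Fin.suc) q′ x ≡⟨ cong (below[ f (Fin.suc q′) ] +_) (smallerAfter-suc f q′ x) ⟨
  below[ f (Fin.suc q′) ] + smallerAfter f (Fin.suc q′) x ∎
  where
  open ≡-Reasoning
  below[_] : Fin _ → ℕ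
  below[ y ] = length (filter (_<ᶠ? x) [ y ])

smallerAfter-next-< : (f : Fin n → Fin m) {q q′ : Fin n} {x : Fin m} → toℕ q′ ≡ suc (toℕ q) →
  f q′ Fin.< x → smallerAfter f q x ≡ suc (smallerAfter f q′ x)
smallerAfter-next-< f {q′ = q′} {x} q′≡1+q fq′<x =
  trans (smallerAfter-next f x q′≡1+q) (cong (λ l → length l + smallerAfter f q′ x) (filter-accept (_<ᶠ? x) fq′<x))

smallerAfter-next-≮ : (f : Fin n → Fin m) {q q′ : Fin n} {x : Fin m} → toℕ q′ ≡ suc (toℕ q) →
  ¬ f q′ Fin.< x → smallerAfter f q x ≡ smallerAfter f q′ x
smallerAfter-next-≮ f {q′ = q′} {x} q′≡1+q fq′≮x =
  trans (smallerAfter-next f x q′≡1+q) (cong (λ l → length l + smallerAfter f q′ x) (filter-reject (_<ᶠ? x) fq′≮x))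

LehmerCriterion : ℕ → ℕ → ℕ → Set
LehmerCriterion ℓ₀ ℓ₁ ℓ₂ = ℓ₂ + 1 < ℓ₀ ⊎ (ℓ₀ ≡ ℓ₂ + 1 × ℓ₀ ≤ ℓ₁)

criterion-both-smaller : ∀ {ℓ₀ ℓ₁ ℓ₂ d₀} → ℓ₀ ≡ 2 + d₀ → ℓ₂ ≤ d₀ → LehmerCriterion ℓ₀ ℓ₁ ℓ₂
criterion-both-smaller {ℓ₂ = ℓ₂} refl ℓ₂≤d₀ rewrite +-comm ℓ₂ 1 = inj₁ (s≤s (s≤s ℓ₂≤d₀))

criterion-last-smaller : ∀ {ℓ₀ ℓ₁ ℓ₂ d₀ d₁} → ℓ₀ ≡ 1 + d₀ → ℓ₁ ≡ 1 + d₁ → ℓ₂ ≤ d₀ → d₀ ≤ d₁ →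
  LehmerCriterion ℓ₀ ℓ₁ ℓ₂
criterion-last-smaller {ℓ₂ = ℓ₂} refl refl ℓ₂≤d₀ d₀≤d₁ rewrite +-comm ℓ₂ 1 with m≤n⇒m<n∨m≡n ℓ₂≤d₀
... | inj₁ ℓ₂<d₀ = inj₁ (s≤s ℓ₂<d₀)
... | inj₂ refl  = inj₂ (refl , s≤s d₀≤d₁)

¬criterion-middle-smaller : ∀ {ℓ₀ ℓ₁ ℓ₂ d₀} → ℓ₀ ≡ 1 + d₀ → ℓ₁ ≤ d₀ → d₀ ≤ ℓ₂ →
  ¬ LehmerCriterion ℓ₀ ℓ₁ ℓ₂
¬criterion-middle-smaller {ℓ₂ = ℓ₂} refl ℓ₁≤d₀ d₀≤ℓ₂ (inj₁ ℓ₂+1<ℓ₀) =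
  m+1+n≰m ℓ₂ (≤-trans (s≤s⁻¹ ℓ₂+1<ℓ₀) d₀≤ℓ₂)
¬criterion-middle-smaller refl ℓ₁≤d₀ d₀≤ℓ₂ (inj₂ (_ , ℓ₀≤ℓ₁)) = n≮n _ (≤-trans ℓ₀≤ℓ₁ ℓ₁≤d₀)

¬criterion-none-smaller : ∀ {ℓ₀ ℓ₁ ℓ₂} → ℓ₀ ≤ ℓ₂ → ¬ LehmerCriterion ℓ₀ ℓ₁ ℓ₂
¬criterion-none-smaller {ℓ₂ = ℓ₂} ℓ₀≤ℓ₂ (inj₁ ℓ₂+1<ℓ₀) = ≤⇒≯ ℓ₀≤ℓ₂ (≤-<-trans (m≤m+n ℓ₂ 1) ℓ₂+1<ℓ₀)
¬criterion-none-smaller {ℓ₂ = ℓ₂} ℓ₀≤ℓ₂ (inj₂ (refl , _)) = m+1+n≰m ℓ₂ ℓ₀≤ℓ₂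

module _ (f : Fin n → Fin m) (f-injective : Injective _≡_ _≡_ f) {q₀ q₁ q₂ : Fin n}
         (q₁≡1+q₀ : toℕ q₁ ≡ suc (toℕ q₀)) (q₂≡1+q₁ : toℕ q₂ ≡ suc (toℕ q₁)) where

  private
    a b c : Fin m
    a = f q₀
    b = f q₁
    c = f q₂

    Criterion : Set
    Criterion = LehmerCriterion (lehmerCode f q₀) (lehmerCode f q₁) (lehmerCode f q₂)

    D : Fin m → ℕ
    D = smallerAfter f q₂

    D-mono : ∀ {x y} → x Fin.< y → D x ≤ D y
    D-mono x<y = smallerAfter-mono f q₂ (<⇒≤ x<y)

    q₀<q₁ : q₀ Fin.< q₁
    q₀<q₁ = ≤-reflexive (sym q₁≡1+q₀)

    q₀<q₂ : q₀ Fin.< q₂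
    q₀<q₂ = <-trans q₀<q₁ (≤-reflexive (sym q₂≡1+q₁))

    f-distinct : ∀ {q q′} → q Fin.< q′ → f q ≢ f q′
    f-distinct q<q′ fq≡fq′ = <⇒≢ q<q′ (f-injective fq≡fq′)

  descent-two-apart⇔lehmerCriterion : f q₂ Fin.< f q₀ ⇔
    LehmerCriterion (lehmerCode f q₀) (lehmerCode f q₁) (lehmerCode f q₂)
  descent-two-apart⇔lehmerCriterion = mk⇔ descent⇒criterion criterion⇒descent
    where
    descent⇒criterion : c Fin.< a → Criterion
    descent⇒criterion c<a with <-cmp b a
    ... | tri< b<a _ _ = criterion-both-smaller
          (trans (smallerAfter-next-< f q₁≡1+q₀ b<a) (cong suc (smallerAfter-next-< f q₂≡1+q₁ c<a)))
          (D-mono c<a)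
    ... | tri≈ _ b≡a _ = contradiction (sym b≡a) (f-distinct q₀<q₁)
    ... | tri> _ _ a<b = criterion-last-smaller
          (trans (smallerAfter-next-≮ f q₁≡1+q₀ (<⇒≯ a<b)) (smallerAfter-next-< f q₂≡1+q₁ c<a))
          (smallerAfter-next-< f q₂≡1+q₁ (<-trans c<a a<b))
          (D-mono c<a) (D-mono a<b)

    ¬criterion : a Fin.< c → ¬ Criterion
    ¬criterion a<c with <-cmp b a
    ... | tri< b<a _ _ = ¬criterion-middle-smaller
          (trans (smallerAfter-next-< f q₁≡1+q₀ b<a) (cong suc (smallerAfter-next-≮ f q₂≡1+q₁ (<⇒≯ a<c))))
          (≤-trans (≤-reflexive (smallerAfter-next-≮ f q₂≡1+q₁ (<⇒≯ (<-trans b<a a<c)))) (D-mono b<a))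
          (D-mono a<c)
    ... | tri≈ _ b≡a _ = contradiction (sym b≡a) (f-distinct q₀<q₁)
    ... | tri> _ _ a<b = ¬criterion-none-smaller
          (≤-trans (≤-reflexive (trans (smallerAfter-next-≮ f q₁≡1+q₀ (<⇒≯ a<b))
                                       (smallerAfter-next-≮ f q₂≡1+q₁ (<⇒≯ a<c))))
                   (D-mono a<c))

    criterion⇒descent : Criterion → c Fin.< a
    criterion⇒descent criterion with <-cmp c a
    ... | tri< c<a _ _ = c<a
    ... | tri≈ _ c≡a _ = contradiction (sym c≡a) (f-distinct q₀<q₂)
    ... | tri> _ _ a<c = contradiction criterion (¬criterion a<c)

toℕ-fromℕ<-suc : ∀ {j k} .(j<n : j < n) .(k<n : k < n) → k ≡ suc j →
  toℕ (fromℕ< k<n) ≡ suc (toℕ (fromℕ< j<n))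
toℕ-fromℕ<-suc j<n k<n refl = trans (toℕ-fromℕ< k<n) (cong suc (sym (toℕ-fromℕ< j<n)))

lemma4p29 : (n : ℕ) (σ : Permutation′ n) (i : ℕ) (h : i + 2 < n) →
    let p0 = fromℕ< {i} {n} (Data.Nat.Properties.≤-<-trans (Data.Nat.Properties.m≤m+n i 2) h)
        p1 = fromℕ< {i + 1} {n} (Data.Nat.Properties.<-trans (Data.Nat.Properties.+-monoʳ-< i (Data.Nat.Properties.n<1+n 1)) h)
        p2 = fromℕ< {i + 2} {n} h
    in (toℕ (σ ⟨$⟩ʳ p2) < toℕ (σ ⟨$⟩ʳ p0))
       ⇔ ((lehmer σ p2 + 1 < lehmer σ p0)
          ⊎ ((lehmer σ p0 ≡ lehmer σ p2 + 1) × (lehmer σ p0 ≤ lehmer σ p1)))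
lemma4p29 n σ i h =
  descent-two-apart⇔lehmerCriterion (σ ⟨$⟩ʳ_) (Injection.injective (↔⇒↣ σ))
    (toℕ-fromℕ<-suc _ _ (+-comm i 1)) (toℕ-fromℕ<-suc _ _ (+-suc i 1))
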